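{- Let $P$ be the definite logic program (NQUEENS) consisting of the clauses \[ \begin{array}{l} \mathit{pqs}(0,\_,\_,\_).\\ \mathit{pqs}(s(I),Cs,Us,[\_|Ds]) \leftarrow \mathit{pqs}(I,Cs,[\_|Us],Ds),\ \mathit{pq}(s(I),Cs,Us,Ds).\\ \mathit{pq}(I,[I|\_],[I|\_],[I|\_]).\\ \mathit{pq}(I,[\_|Cs],[\_|Us],[\_|Ds]) \leftarrow \mathit{pq}(I,Cs,Us,Ds). \end{array} \] Let $Q_0'=\mathit{pqs}(n,t_1,t_2,t_3)$ where $n$ is ground and $t_1,t_2,t_3$ are arbitrary terms. Then there exists a strategy of selecting equations and actions in the Martelli–Montanari algorithm such that action (6) (halting on the occur-check) is not performed in any unification available in any SLD-derivation for $P$ with $Q_0'$ (under any selection rule).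
   Context: Prolog notation: upper-case identifiers are variables; $0$ a constant, $s$ unary; $[H|T]$ the list constructor; each $\_$ is a distinct fresh variable. The Martelli–Montanari algorithm (MMA) on a finite set of equations between terms repeatedly and nondeterministically selects an equation of one of the following forms and performs the action: (1) $f(s_1,\dots,s_n)=f(t_1,\dots,t_n)$: replace it by $s_1=t_1,\dots,s_n=t_n$; (2) $f(\dots)=g(\dots)$ with $f\neq g$: halt with failure; (3) $X=X$: delete it; (4) $t=X$ with $t$ not a variable: replace by $X=t$; (5) $X=t$ with $X\notin\mathrm{Var}(t)$ and $X$ occurring elsewhere: apply $\{X/t\}$ to all other equations; (6) $X=t$ with $X\in\mathrm{Var}(t)$ and $X\neq t$: halt with failure. It stops with success when no action applies. In an SLD-derivation for $P$, the unification of $A$ and $H$ (the equation set $\{A=H\}$) is available if $A$ is the selected atom of some query and $H$ is a standardized-apart head of a clause of $P$ with the same predicate symbol. -}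

module Defs where

open import Data.Nat using (ℕ; zero; suc)
open import Data.List using (List; []; _∷_; _++_; [_]; map; zip; length; concatMap; concat)
open import Data.List.Membership.Propositional using (_∈_)
open import Data.List.Relation.Unary.Unique.Propositional using (Unique)
open import Data.List.Relation.Unary.All using (All)
open import Data.Product using (Σ; _×_; _,_; proj₁; proj₂)
open import Relation.Binary.PropositionalEquality using (_≡_; _≢_)
open import Relation.Nullary using (¬_)
open import Function.Definitions using (Injective)
open import Data.Empty using (⊥)

-- A function (or predicate) symbol is a name together with its arity;
-- the arity is the length of the argument list.  The names 0, s, [_|_],
-- pqs, pq are distinguished; arbitrary other names are available
-- (so the query arguments t1,t2,t3 are genuinely arbitrary terms).

data Sym : Set where
  zeroS sS consS pqsS pqS : Sym
  other : ℕ → Sym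

data Term : Set where
  var : ℕ → Term
  fn  : Sym → List Term → Term

mutual
  vars : Term → List ℕ
  vars (var x)   = x ∷ []
  vars (fn f ts) = varsL ts

  varsL : List Term → List ℕ
  varsL []       = []
  varsL (t ∷ ts) = vars t ++ varsL ts

Ground : Term → Set
Ground t = vars t ≡ []

SameSymbol : Term → Term → Set
SameSymbol (fn f ss) (fn g ts) = (f ≡ g) × (length ss ≡ length ts)
SameSymbol _ _ = ⊥

z : Term
z = fn zeroS []

s : Term → Term
s t = fn sS (t ∷ [])

[_∣_] : Term → Term → Term
[ h ∣ t ] = fn consS (h ∷ t ∷ [])

pqs : Term → Term → Term → Term → Term
pqs a b c d = fn pqsS (a ∷ b ∷ c ∷ d ∷ [])

pq : Term → Term → Term → Term → Term
pq a b c d = fn pqS (a ∷ b ∷ c ∷ d ∷ [])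

mutual
  rename : (ℕ → ℕ) → Term → Term
  rename ρ (var x)   = var (ρ x)
  rename ρ (fn f ts) = fn f (renameL ρ ts)

  renameL : (ℕ → ℕ) → List Term → List Term
  renameL ρ []       = []
  renameL ρ (t ∷ ts) = rename ρ t ∷ renameL ρ ts

mutual
  subst1 : ℕ → Term → Term → Term
  subst1 x t (var y) with x Data.Nat.≟ y
  ... | Relation.Nullary.yes _ = t
  ... | Relation.Nullary.no  _ = var y
  subst1 x t (fn f us) = fn f (subst1L x t us)

  subst1L : ℕ → Term → List Term → List Term
  subst1L x t []       = []
  subst1L x t (u ∷ us) = subst1 x t u ∷ subst1L x t us

Binding : Set
Binding = ℕ × Term

Subst : Set
Subst = List Binding

lookupS : Subst → ℕ → Term
lookupS []            y = var y
lookupS ((x , t) ∷ θ) y with x Data.Nat.≟ y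
... | Relation.Nullary.yes _ = t
... | Relation.Nullary.no  _ = lookupS θ y

mutual
  applyS : Subst → Term → Term
  applyS θ (var y)   = lookupS θ y
  applyS θ (fn f ts) = fn f (applySL θ ts)

  applySL : Subst → List Term → List Term
  applySL θ []       = []
  applySL θ (t ∷ ts) = applyS θ t ∷ applySL θ ts

WFSubst : Subst → Set
WFSubst θ = Unique (map proj₁ θ) × All (λ b → var (proj₁ b) ≢ proj₂ b) θ

varsS : Subst → List ℕ
varsS θ = map proj₁ θ ++ varsL (map proj₂ θ)

Unifier : Subst → Term → Term → Set
Unifier θ a b = applyS θ a ≡ applyS θ b

MGU : Subst → Term → Term → Set
MGU θ a b =
  WFSubst θ × Unifier θ a b ×
  ((η : Subst) → WFSubst η → Unifier η a b →
     Σ Subst (λ δ → (u : Term) → applyS η u ≡ applyS δ (applyS θ u)))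

Eqn : Set
Eqn = Term × Term

EqSet : Set
EqSet = List Eqn

varsE : EqSet → List ℕ
varsE [] = []
varsE ((a , b) ∷ E) = vars a ++ vars b ++ varsE E

substE : ℕ → Term → EqSet → EqSet
substE x t = map (λ e → subst1 x t (proj₁ e) , subst1 x t (proj₂ e))

IsVar : Term → Set
IsVar t = Σ ℕ (λ x → t ≡ var x)

data Act : Set where
  act1 act2 act3 act4 act5 act6 : Act

data Outcome : Set where
  next : EqSet → Outcome
  halt : Outcome

-- One step of MMA: selecting an equation (the one between L and R) and
-- performing the given action.
data Step : EqSet → Act → Outcome → Set where
  step1 : ∀ L R f ss ts → length ss ≡ length ts →
          Step (L ++ (fn f ss , fn f ts) ∷ R) act1 (next (L ++ zip ss ts ++ R))
  step2 : ∀ L R f g ss ts → ¬ ((f ≡ g) × (length ss ≡ length ts)) →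
          Step (L ++ (fn f ss , fn g ts) ∷ R) act2 halt
  step3 : ∀ L R x →
          Step (L ++ (var x , var x) ∷ R) act3 (next (L ++ R))
  step4 : ∀ L R t x → ¬ IsVar t →
          Step (L ++ (t , var x) ∷ R) act4 (next (L ++ (var x , t) ∷ R))
  step5 : ∀ L R x t → ¬ (x ∈ vars t) → x ∈ varsE (L ++ R) →
          Step (L ++ (var x , t) ∷ R) act5
               (next (substE x t L ++ (var x , t) ∷ substE x t R))
  step6 : ∀ L R x t → x ∈ vars t → var x ≢ t →
          Step (L ++ (var x , t) ∷ R) act6 halt

Applicable : EqSet → Set
Applicable E = Σ Act (λ a → Σ Outcome (λ o → Step E a o))

-- A strategy: whenever some action applies to the current set of
-- equations, it chooses one (an equation together with an action).
Strategy : Set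
Strategy = (E : EqSet) → Applicable E → Applicable E

data Reaches (σ : Strategy) (E₀ : EqSet) : EqSet → Set where
  start : Reaches σ E₀ E₀
  cont  : ∀ {E E'} → Reaches σ E₀ E → (ap : Applicable E) →
          proj₁ (proj₂ (σ E ap)) ≡ next E' → Reaches σ E₀ E'

NoOccurCheckHalt : Strategy → EqSet → Set
NoOccurCheckHalt σ E₀ =
  ∀ E → Reaches σ E₀ E → (ap : Applicable E) → proj₁ (σ E ap) ≢ act6

record Clause : Set where
  constructor _←_
  field
    head : Term
    body : List Term
open Clause public

varsC : Clause → List ℕ
varsC c = vars (head c) ++ varsL (body c)

renameC : (ℕ → ℕ) → Clause → Clause
renameC ρ c = rename ρ (head c) ← renameL ρ (body c)

Query : Set
Query = List Term

-- The program NQUEENS.  Each _ is a distinct fresh variable.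
private
  v : ℕ → Term
  v = var

NQUEENS : List Clause
NQUEENS =
  (pqs z (v 0) (v 1) (v 2) ← []) ∷
  -- pqs(s(I),Cs,Us,[_|Ds]) ← pqs(I,Cs,[_|Us],Ds), pq(s(I),Cs,Us,Ds).
  --   I=0, Cs=1, Us=2, _=3, Ds=4, _=5
  (pqs (s (v 0)) (v 1) (v 2) [ v 3 ∣ v 4 ] ←
     (pqs (v 0) (v 1) [ v 5 ∣ v 2 ] (v 4) ∷ pq (s (v 0)) (v 1) (v 2) (v 4) ∷ [])) ∷
  (pq (v 0) [ v 0 ∣ v 1 ] [ v 0 ∣ v 2 ] [ v 0 ∣ v 3 ] ← []) ∷
  -- pq(I,[_|Cs],[_|Us],[_|Ds]) ← pq(I,Cs,Us,Ds).
  --   I=0, _=1, Cs=2, _=3, Us=4, _=5, Ds=6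
  (pq (v 0) [ v 1 ∣ v 2 ] [ v 3 ∣ v 4 ] [ v 5 ∣ v 6 ] ←
     (pq (v 0) (v 2) (v 4) (v 6) ∷ [])) ∷
  []

StdApartVariant : List Clause → List ℕ → Clause → Set
StdApartVariant P used c' =
  Σ Clause (λ c → c ∈ P × Σ (ℕ → ℕ) (λ ρ → Injective _≡_ _≡_ ρ ×
     c' ≡ renameC ρ c × (∀ x → x ∈ varsC c' → ¬ (x ∈ used))))

-- The
-- list of naturals records all variables used so far (those of Q₀ and
-- of all clause variants and mgus used), so that each new clause
-- variant is standardized apart from Q₀,…,Qᵢ and θ₁,…,θᵢ.  Any atom
-- may be selected (arbitrary selection rule) and any mgu may be used.
data SLDReach (P : List Clause) (Q₀ : Query) : Query → List ℕ → Set where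
  start : SLDReach P Q₀ Q₀ (varsL Q₀)
  step  : ∀ {U} L A R c' θ →
          SLDReach P Q₀ (L ++ A ∷ R) U →
          StdApartVariant P U c' →
          SameSymbol A (head c') →
          MGU θ A (head c') →
          SLDReach P Q₀ (applySL θ (L ++ body c' ++ R))
                        (U ++ varsC c' ++ varsS θ)

Available : List Clause → Query → Term → Term → Set
Available P Q₀ A H =
  Σ Query (λ L → Σ Query (λ R → Σ (List ℕ) (λ U →
    SLDReach P Q₀ (L ++ A ∷ R) U ×
    Σ Clause (λ c' → StdApartVariant P U c' × H ≡ head c' × SameSymbol A H))))

-- σ performs the leftmost action other than (6).  Along its runs the equation set has the form
-- θ ∪ U with θ in solved form, Dom(θ) absent from U, the right-hand sides of U linear and pairwise
-- variable-disjoint, no variable on both a left- and a right-hand side of U, and Ran(θ) disjoint from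
-- the right-hand sides of U.  Decomposing, swapping or eliminating the leftmost equation of U keeps
-- this form, so no selected equation X = t ever has X ∈ Var(t) with X ≠ t, and once U is empty no
-- action applies at all.
-- Every available unification A = H reaches this form: A and the standardized-apart head H are
-- variable-disjoint and three of the four heads are linear.  For H = pq(I,[I|_],[I|_],[I|_]) the
-- first argument of A is ground, because every query of a derivation from pqs(n,t₁,t₂,t₃) is
-- well-moded; σ first binds I to that ground term, after which the right-hand sides [g|_] are linear.

module Submission where

open import Defs
open import Data.Empty using (⊥; ⊥-elim)
open import Data.List using (List; []; _∷_; _++_; [_]; map; zip; length; upTo)
open import Data.List.Membership.Propositional using (_∈_; _∉_)
open import Data.List.Membership.Propositional.Properties using (∈-++⁺ˡ; ∈-++⁺ʳ; ∈-++⁻)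
open import Data.List.Properties using (++-assoc; ++-identityʳ; ++-conicalˡ; ++-conicalʳ; ∷-injective; map-++)
open import Data.List.Relation.Binary.Disjoint.Propositional using (Disjoint)
open import Data.List.Relation.Binary.Subset.Propositional using (_⊆_)
open import Data.List.Relation.Unary.All using (All; []; _∷_)
import Data.List.Relation.Unary.All as All
import Data.List.Relation.Unary.All.Properties as AllP
open import Data.List.Relation.Unary.Any using (here; there)
open import Data.List.Relation.Unary.Any.Properties using (¬Any[])
open import Data.List.Relation.Unary.Unique.Propositional using (Unique; []; _∷_)
import Data.List.Relation.Unary.Unique.Propositional as Unique
open import Data.List.Relation.Unary.Unique.Propositional.Properties
  using (map⁺; upTo⁺; Unique[x∷xs]⇒x∉xs)
import Data.List.Relation.Unary.Unique.Propositional.Properties as UniqueProps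
open import Data.Maybe using (Maybe; just; nothing; maybe′; _<∣>_)
import Data.Maybe as Maybe
open import Data.Maybe.Properties using (just-injective)
open import Data.Nat using (ℕ; suc; _+_; _≟_)
open import Data.Nat.Properties using (suc-injective)
open import Data.List.Membership.DecPropositional _≟_ using (_∈?_)
open import Data.Product using (Σ; ∃; _×_; _,_; proj₁; proj₂)
import Data.Product as Product
open import Data.Sum using (_⊎_; inj₁; inj₂)
import Data.Sum as Sum
open import Function using (_∘_)
open import Function.Definitions using (Injective)
open import Relation.Binary.Definitions using (DecidableEquality)
open import Relation.Binary.PropositionalEquality
  using (_≡_; _≢_; refl; sym; trans; cong; cong₂; subst; subst₂; module ≡-Reasoning)
open import Relation.Nullary using (¬_; yes; no)
open import Relation.Nullary.Decidable using (map′; _×-dec_)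

symCode : Sym → ℕ
symCode zeroS     = 0
symCode sS        = 1
symCode consS     = 2
symCode pqsS      = 3
symCode pqS       = 4
symCode (other n) = 5 + n

symDecode : ℕ → Sym
symDecode 0 = zeroS
symDecode 1 = sS
symDecode 2 = consS
symDecode 3 = pqsS
symDecode 4 = pqS
symDecode (suc (suc (suc (suc (suc n))))) = other n

symDecode-symCode : ∀ f → symDecode (symCode f) ≡ f
symDecode-symCode zeroS     = refl
symDecode-symCode sS        = refl
symDecode-symCode consS     = refl
symDecode-symCode pqsS      = refl
symDecode-symCode pqS       = refl
symDecode-symCode (other n) = refl

symCode-injective : Injective _≡_ _≡_ symCode
symCode-injective {f} {g} eq =
  trans (sym (symDecode-symCode f)) (trans (cong symDecode eq) (symDecode-symCode g))

_≟Sym_ : DecidableEquality Sym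
f ≟Sym g = map′ symCode-injective (cong symCode) (symCode f ≟ symCode g)

mutual
  subst1-vars⁻ : ∀ x t u {y} → y ∈ vars (subst1 x t u) → (y ∈ vars u × y ≢ x) ⊎ y ∈ vars t
  subst1-vars⁻ x t (var z) p with x ≟ z
  ... | yes refl = inj₂ p
  subst1-vars⁻ x t (var z) (here refl) | no x≢z = inj₁ (here refl , x≢z ∘ sym)
  subst1-vars⁻ x t (fn f us) p = subst1L-vars⁻ x t us p

  subst1L-vars⁻ : ∀ x t us {y} → y ∈ varsL (subst1L x t us) → (y ∈ varsL us × y ≢ x) ⊎ y ∈ vars t
  subst1L-vars⁻ x t (u ∷ us) p with ∈-++⁻ (vars (subst1 x t u)) p
  ... | inj₁ q = Sum.map₁ (Product.map₁ ∈-++⁺ˡ) (subst1-vars⁻ x t u q)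
  ... | inj₂ q = Sum.map₁ (Product.map₁ (∈-++⁺ʳ (vars u))) (subst1L-vars⁻ x t us q)

mutual
  subst1-fresh : ∀ x t u → x ∉ vars u → subst1 x t u ≡ u
  subst1-fresh x t (var z) x∉u with x ≟ z
  ... | yes refl = ⊥-elim (x∉u (here refl))
  ... | no _     = refl
  subst1-fresh x t (fn f us) x∉u = cong (fn f) (subst1L-fresh x t us x∉u)

  subst1L-fresh : ∀ x t us → x ∉ varsL us → subst1L x t us ≡ us
  subst1L-fresh x t []       _   = refl
  subst1L-fresh x t (u ∷ us) x∉us =
    cong₂ _∷_ (subst1-fresh x t u (x∉us ∘ ∈-++⁺ˡ)) (subst1L-fresh x t us (x∉us ∘ ∈-++⁺ʳ (vars u)))

subst1-var-self : ∀ x t → subst1 x t (var x) ≡ t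
subst1-var-self x t with x ≟ x
... | yes _   = refl
... | no x≢x  = ⊥-elim (x≢x refl)

varsL-++ : ∀ ts us → varsL (ts ++ us) ≡ varsL ts ++ varsL us
varsL-++ []       us = refl
varsL-++ (t ∷ ts) us =
  trans (cong (vars t ++_) (varsL-++ ts us)) (sym (++-assoc (vars t) (varsL ts) (varsL us)))

unique-++⁻ʳ : ∀ (xs : List ℕ) {ys} → Unique (xs ++ ys) → Unique ys
unique-++⁻ʳ []       u       = u
unique-++⁻ʳ (x ∷ xs) (_ ∷ u) = unique-++⁻ʳ xs u

unique-++⇒disjoint : ∀ (xs : List ℕ) {ys} → Unique (xs ++ ys) → Disjoint xs ys
unique-++⇒disjoint (x ∷ xs) (x∉ ∷ _) (here refl , q) = All.lookup x∉ (∈-++⁺ʳ xs q) refl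
unique-++⇒disjoint (x ∷ xs) (_ ∷ u)  (there p , q)   = unique-++⇒disjoint xs u (p , q)

lhsVars rhsVars : EqSet → List ℕ
lhsVars E = varsL (map proj₁ E)
rhsVars E = varsL (map proj₂ E)

varsE-++ : ∀ E F → varsE (E ++ F) ≡ varsE E ++ varsE F
varsE-++ []            F = refl
varsE-++ ((a , b) ∷ E) F = begin
  vars a ++ vars b ++ varsE (E ++ F)      ≡⟨ cong (λ V → vars a ++ vars b ++ V) (varsE-++ E F) ⟩
  vars a ++ vars b ++ varsE E ++ varsE F  ≡⟨ cong (vars a ++_) (sym (++-assoc (vars b) (varsE E) (varsE F))) ⟩
  vars a ++ (vars b ++ varsE E) ++ varsE F ≡⟨ sym (++-assoc (vars a) _ (varsE F)) ⟩
  (vars a ++ vars b ++ varsE E) ++ varsE F ∎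
  where open ≡-Reasoning

module _ {x : ℕ} where

  ∈-varsE-++⁻ : ∀ E F → x ∈ varsE (E ++ F) → x ∈ varsE E ⊎ x ∈ varsE F
  ∈-varsE-++⁻ E F p = ∈-++⁻ (varsE E) (subst (x ∈_) (varsE-++ E F) p)

  ∈-varsE-++⁺ˡ : ∀ E F → x ∈ varsE E → x ∈ varsE (E ++ F)
  ∈-varsE-++⁺ˡ E F p = subst (x ∈_) (sym (varsE-++ E F)) (∈-++⁺ˡ p)

  ∈-varsE-++⁺ʳ : ∀ E F → x ∈ varsE F → x ∈ varsE (E ++ F)
  ∈-varsE-++⁺ʳ E F p = subst (x ∈_) (sym (varsE-++ E F)) (∈-++⁺ʳ (varsE E) p)

  ∈-varsE⁻ : ∀ E → x ∈ varsE E → x ∈ lhsVars E ⊎ x ∈ rhsVars E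
  ∈-varsE⁻ ((a , b) ∷ E) p with ∈-++⁻ (vars a) p
  ... | inj₁ q = inj₁ (∈-++⁺ˡ q)
  ... | inj₂ q with ∈-++⁻ (vars b) q
  ...   | inj₁ r = inj₂ (∈-++⁺ˡ r)
  ...   | inj₂ r = Sum.map (∈-++⁺ʳ (vars a)) (∈-++⁺ʳ (vars b)) (∈-varsE⁻ E r)

  ∈-varsE⁺ˡ : ∀ E → x ∈ lhsVars E → x ∈ varsE E
  ∈-varsE⁺ˡ ((a , b) ∷ E) p with ∈-++⁻ (vars a) p
  ... | inj₁ q = ∈-++⁺ˡ q
  ... | inj₂ q = ∈-++⁺ʳ (vars a) (∈-++⁺ʳ (vars b) (∈-varsE⁺ˡ E q))

  ∈-varsE⁺ʳ : ∀ E → x ∈ rhsVars E → x ∈ varsE E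
  ∈-varsE⁺ʳ ((a , b) ∷ E) p with ∈-++⁻ (vars b) p
  ... | inj₁ q = ∈-++⁺ʳ (vars a) (∈-++⁺ˡ q)
  ... | inj₂ q = ∈-++⁺ʳ (vars a) (∈-++⁺ʳ (vars b) (∈-varsE⁺ʳ E q))

lhs-substE : ∀ x t E → map proj₁ (substE x t E) ≡ subst1L x t (map proj₁ E)
lhs-substE x t []      = refl
lhs-substE x t (e ∷ E) = cong (subst1 x t (proj₁ e) ∷_) (lhs-substE x t E)

rhs-substE : ∀ x t E → map proj₂ (substE x t E) ≡ subst1L x t (map proj₂ E)
rhs-substE x t []      = refl
rhs-substE x t (e ∷ E) = cong (subst1 x t (proj₂ e) ∷_) (rhs-substE x t E)

∈-lhsVars-substE⁻ : ∀ x t E {y} → y ∈ lhsVars (substE x t E) → (y ∈ lhsVars E × y ≢ x) ⊎ y ∈ vars t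
∈-lhsVars-substE⁻ x t E {y} p =
  subst1L-vars⁻ x t (map proj₁ E) (subst (λ ts → y ∈ varsL ts) (lhs-substE x t E) p)

rhsVars-substE-fresh : ∀ x t E → x ∉ rhsVars E → rhsVars (substE x t E) ≡ rhsVars E
rhsVars-substE-fresh x t E x∉ = cong varsL (trans (rhs-substE x t E) (subst1L-fresh x t (map proj₂ E) x∉))

substE-fresh : ∀ x t E → x ∉ varsE E → substE x t E ≡ E
substE-fresh x t []            _   = refl
substE-fresh x t ((a , b) ∷ E) x∉ = cong₂ _∷_
  (cong₂ _,_ (subst1-fresh x t a (x∉ ∘ ∈-++⁺ˡ)) (subst1-fresh x t b (x∉ ∘ ∈-++⁺ʳ (vars a) ∘ ∈-++⁺ˡ)))
  (substE-fresh x t E (x∉ ∘ ∈-++⁺ʳ (vars a) ∘ ∈-++⁺ʳ (vars b)))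

lhsVars-zip-++ : ∀ ss ts U → length ss ≡ length ts → lhsVars (zip ss ts ++ U) ≡ varsL ss ++ lhsVars U
lhsVars-zip-++ []       []       U _   = refl
lhsVars-zip-++ (s ∷ ss) (t ∷ ts) U len =
  trans (cong (vars s ++_) (lhsVars-zip-++ ss ts U (suc-injective len))) (sym (++-assoc (vars s) (varsL ss) _))

rhsVars-zip-++ : ∀ ss ts U → length ss ≡ length ts → rhsVars (zip ss ts ++ U) ≡ varsL ts ++ rhsVars U
rhsVars-zip-++ []       []       U _   = refl
rhsVars-zip-++ (s ∷ ss) (t ∷ ts) U len =
  trans (cong (vars t ++_) (rhsVars-zip-++ ss ts U (suc-injective len))) (sym (++-assoc (vars t) (varsL ts) _))

∈-varsE-substE⁻ : ∀ Y r U {x} → x ∈ varsE (substE Y r U) → (x ∈ varsE U × x ≢ Y) ⊎ x ∈ vars r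
∈-varsE-substE⁻ Y r U {x} p with ∈-varsE⁻ (substE Y r U) p
... | inj₁ q = Sum.map₁ (Product.map₁ (∈-varsE⁺ˡ U)) (∈-lhsVars-substE⁻ Y r U q)
... | inj₂ q = Sum.map₁ (Product.map₁ (∈-varsE⁺ʳ U))
                 (subst1L-vars⁻ Y r (map proj₂ U) (subst (λ ts → x ∈ varsL ts) (rhs-substE Y r U) q))

dom ranVars : Subst → List ℕ
dom = map proj₁
ranVars θ = varsL (map proj₂ θ)

toEqs : Subst → EqSet
toEqs = map (λ (x , t) → var x , t)

substS : ℕ → Term → Subst → Subst
substS x t = map (Product.map₂ (subst1 x t))

∈-varsE-toEqs⁻ : ∀ θ {x} → x ∈ varsE (toEqs θ) → x ∈ dom θ ⊎ x ∈ ranVars θ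
∈-varsE-toEqs⁻ ((y , u) ∷ θ) (here refl) = inj₁ (here refl)
∈-varsE-toEqs⁻ ((y , u) ∷ θ) (there p) with ∈-++⁻ (vars u) p
... | inj₁ q = inj₂ (∈-++⁺ˡ q)
... | inj₂ q = Sum.map there (∈-++⁺ʳ (vars u)) (∈-varsE-toEqs⁻ θ q)

∈-varsE-toEqs⁺ : ∀ θ {x} → x ∈ ranVars θ → x ∈ varsE (toEqs θ)
∈-varsE-toEqs⁺ ((y , u) ∷ θ) p with ∈-++⁻ (vars u) p
... | inj₁ q = there (∈-++⁺ˡ q)
... | inj₂ q = there (∈-++⁺ʳ (vars u) (∈-varsE-toEqs⁺ θ q))

dom-substS : ∀ x t θ → dom (substS x t θ) ≡ dom θ
dom-substS x t []      = refl
dom-substS x t (b ∷ θ) = cong (proj₁ b ∷_) (dom-substS x t θ)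

ran-substS : ∀ x t θ → map proj₂ (substS x t θ) ≡ subst1L x t (map proj₂ θ)
ran-substS x t []      = refl
ran-substS x t (b ∷ θ) = cong (subst1 x t (proj₂ b) ∷_) (ran-substS x t θ)

substS-fresh : ∀ x t θ → x ∉ ranVars θ → substS x t θ ≡ θ
substS-fresh x t []            _   = refl
substS-fresh x t ((y , u) ∷ θ) x∉ =
  cong₂ _∷_ (cong (y ,_) (subst1-fresh x t u (x∉ ∘ ∈-++⁺ˡ))) (substS-fresh x t θ (x∉ ∘ ∈-++⁺ʳ (vars u)))

substE-toEqs : ∀ x t θ → x ∉ dom θ → substE x t (toEqs θ) ≡ toEqs (substS x t θ)
substE-toEqs x t []            _   = refl
substE-toEqs x t ((y , u) ∷ θ) x∉ =
  cong₂ _∷_ (cong (_, subst1 x t u) (subst1-fresh x t (var y) λ { (here refl) → x∉ (here refl) }))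
            (substE-toEqs x t θ (x∉ ∘ there))

record Solved (θ : Subst) : Set where
  field
    dom-unique : Unique (dom θ)
    dom#ran    : Disjoint (dom θ) (ranVars θ)

-- θ{Y/r} ∪ {Y/r}, the solved part after action (5) on Y = r.
extend : ℕ → Term → Subst → Subst
extend Y r θ = substS Y r θ ++ [ (Y , r) ]

module _ {Y : ℕ} {r : Term} {θ : Subst} {x : ℕ} where

  ∈-dom-extend⁻ : x ∈ dom (extend Y r θ) → x ∈ dom θ ⊎ x ≡ Y
  ∈-dom-extend⁻ p rewrite map-++ proj₁ (substS Y r θ) [ (Y , r) ] | dom-substS Y r θ
    with ∈-++⁻ (dom θ) p
  ... | inj₁ q         = inj₁ q
  ... | inj₂ (here eq) = inj₂ eq

  ∈-ranVars-extend⁻ : x ∈ ranVars (extend Y r θ) → (x ∈ ranVars θ × x ≢ Y) ⊎ x ∈ vars r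
  ∈-ranVars-extend⁻ p rewrite map-++ proj₂ (substS Y r θ) [ (Y , r) ]
                            | varsL-++ (map proj₂ (substS Y r θ)) [ r ]
    with ∈-++⁻ (ranVars (substS Y r θ)) p
  ... | inj₁ q = subst1L-vars⁻ Y r (map proj₂ θ) (subst (λ ts → x ∈ varsL ts) (ran-substS Y r θ) q)
  ... | inj₂ q = inj₂ (subst (x ∈_) (++-identityʳ (vars r)) q)

extend-disjoint : ∀ {D V R : List ℕ} {Y} → Disjoint D V → Disjoint D R → Y ∉ R →
                  ∀ {x} → x ∈ D ⊎ x ≡ Y → (x ∈ V × x ≢ Y) ⊎ x ∈ R → ⊥
extend-disjoint dom#V dom#r Y∉r (inj₁ p)    (inj₁ (q , _))   = dom#V (p , q)
extend-disjoint dom#V dom#r Y∉r (inj₁ p)    (inj₂ q)         = dom#r (p , q)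
extend-disjoint dom#V dom#r Y∉r (inj₂ refl) (inj₁ (_ , Y≢Y)) = Y≢Y refl
extend-disjoint dom#V dom#r Y∉r (inj₂ refl) (inj₂ q)         = Y∉r q

solved-extend : ∀ {θ Y r} → Solved θ → Y ∉ dom θ → Disjoint (dom θ) (vars r) → Y ∉ vars r →
                Solved (extend Y r θ)
solved-extend {θ} {Y} {r} solved Y∉dom dom#r Y∉r = record
  { dom-unique = subst Unique (sym domEq)
      (UniqueProps.++⁺ dom-unique ([] ∷ []) λ { (p , here refl) → Y∉dom p })
  ; dom#ran    = λ (p , q) → extend-disjoint dom#ran dom#r Y∉r
                               (∈-dom-extend⁻ {Y} {r} {θ} p) (∈-ranVars-extend⁻ {Y} {r} {θ} q) }
  where
  open Solved solved
  domEq : dom (extend Y r θ) ≡ dom θ ++ [ Y ]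
  domEq = trans (map-++ proj₁ (substS Y r θ) [ (Y , r) ]) (cong (_++ [ Y ]) (dom-substS Y r θ))

module _ {x : ℕ} {u : Term} {θ : Subst} (solved : Solved ((x , u) ∷ θ)) where
  open Solved solved

  solved-∷⁻ : Solved θ
  solved-∷⁻ = record
    { dom-unique = Unique.tail dom-unique
    ; dom#ran    = λ (p , q) → dom#ran (there p , ∈-++⁺ʳ (vars u) q) }

  solved-head-fresh : x ∉ vars u × x ∉ varsE (toEqs θ)
  solved-head-fresh = (λ p → dom#ran (here refl , ∈-++⁺ˡ p)) , λ p → fresh (∈-varsE-toEqs⁻ θ p)
    where
    fresh : x ∈ dom θ ⊎ x ∈ ranVars θ → ⊥
    fresh (inj₁ p) = Unique[x∷xs]⇒x∉xs dom-unique p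
    fresh (inj₂ p) = dom#ran (here refl , ∈-++⁺ʳ (vars u) p)

toEqs-extend : ∀ θ Y r U → Y ∉ dom θ →
  substE Y r (toEqs θ) ++ (var Y , r) ∷ substE Y r U ≡ toEqs (extend Y r θ) ++ substE Y r U
toEqs-extend θ Y r U Y∉dom = begin
  substE Y r (toEqs θ) ++ (var Y , r) ∷ substE Y r U     ≡⟨ cong (_++ _) (substE-toEqs Y r θ Y∉dom) ⟩
  toEqs (substS Y r θ) ++ [ (var Y , r) ] ++ substE Y r U ≡⟨ ++-assoc (toEqs (substS Y r θ)) _ _ ⟨
  (toEqs (substS Y r θ) ++ [ (var Y , r) ]) ++ substE Y r U ≡⟨ cong (_++ _) (map-++ _ (substS Y r θ) _) ⟨
  toEqs (extend Y r θ) ++ substE Y r U ∎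
  where open ≡-Reasoning

toEqs-∷ʳ : ∀ θ Y r → toEqs θ ++ [ (var Y , r) ] ≡ toEqs (θ ++ [ (Y , r) ])
toEqs-∷ʳ θ Y r = sym (map-++ _ θ [ (Y , r) ])

SafeStep : EqSet → Set
SafeStep E = Σ Act λ a → Σ Outcome λ o → Step E a o × a ≢ act6

outcome : ∀ {E} → Maybe (SafeStep E) → Maybe Outcome
outcome = Maybe.map (proj₁ ∘ proj₂)

varStep : ∀ L x t R → Maybe (SafeStep (L ++ (var x , t) ∷ R))
varStep L x t R with x ∈? vars t | x ∈? varsE (L ++ R)
... | no x∉t | yes x∈LR = just (act5 , _ , step5 L R x t x∉t x∈LR , λ ())
... | no _   | no _     = nothing
varStep L x (var x) R   | yes (here refl) | _ = just (act3 , _ , step3 L R x , λ ())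
varStep L x (fn f ts) R | yes _           | _ = nothing

safeStepAt : ∀ L e R → Maybe (SafeStep (L ++ e ∷ R))
safeStepAt L (var x , t) R = varStep L x t R
safeStepAt L (fn f ss , var x) R = just (act4 , _ , step4 L R (fn f ss) x (λ { (_ , ()) }) , λ ())
safeStepAt L (fn f ss , fn g ts) R with (f ≟Sym g) ×-dec (length ss ≟ length ts)
... | yes (refl , len) = just (act1 , _ , step1 L R f ss ts len , λ ())
... | no clash         = just (act2 , _ , step2 L R f g ss ts clash , λ ())

-- L is the part of the equation set already passed over.
leftmost : ∀ L M → Maybe (SafeStep (L ++ M))
leftmost L []      = nothing
leftmost L (e ∷ R) =
  safeStepAt L e R <∣> subst (Maybe ∘ SafeStep) (++-assoc L [ e ] R) (leftmost (L ++ [ e ]) R)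

-- σ falls back on the given action only when no action other than (6) applies; the invariant of its
-- runs guarantees that then no action applies at all.
σ : Strategy
σ E ap = maybe′ (λ (a , o , st , _) → a , o , st) ap (leftmost [] E)

varStep-eliminates : ∀ L x t R → x ∉ vars t → x ∈ varsE (L ++ R) →
  outcome (varStep L x t R) ≡ just (next (substE x t L ++ (var x , t) ∷ substE x t R))
varStep-eliminates L x t R x∉t x∈LR with x ∈? vars t | x ∈? varsE (L ++ R)
... | no _  | yes _    = refl
... | no _  | no x∉LR  = ⊥-elim (x∉LR x∈LR)
... | yes p | _        = ⊥-elim (x∉t p)

varStep-inert : ∀ L x t R → x ∉ vars t → x ∉ varsE (L ++ R) → outcome (varStep L x t R) ≡ nothing
varStep-inert L x t R x∉t x∉LR with x ∈? vars t | x ∈? varsE (L ++ R)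
... | no _  | no _    = refl
... | no _  | yes p   = ⊥-elim (x∉LR p)
... | yes p | _       = ⊥-elim (x∉t p)

safeStepAt-decomposes : ∀ L f g ss ts R → f ≡ g × length ss ≡ length ts →
  outcome (safeStepAt L (fn f ss , fn g ts) R) ≡ just (next (L ++ zip ss ts ++ R))
safeStepAt-decomposes L f g ss ts R same with (f ≟Sym g) ×-dec (length ss ≟ length ts)
... | yes (refl , _) = refl
... | no clash       = ⊥-elim (clash same)

safeStepAt-clashes : ∀ L f g ss ts R → ¬ (f ≡ g × length ss ≡ length ts) →
  outcome (safeStepAt L (fn f ss , fn g ts) R) ≡ just halt
safeStepAt-clashes L f g ss ts R clash with (f ≟Sym g) ×-dec (length ss ≟ length ts)
... | yes same = ⊥-elim (clash same)
... | no _     = refl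

outcome-subst : ∀ {E F} (eq : E ≡ F) (m : Maybe (SafeStep E)) →
                outcome (subst (Maybe ∘ SafeStep) eq m) ≡ outcome m
outcome-subst refl m = refl

leftmost-here : ∀ L e R {o} → outcome (safeStepAt L e R) ≡ just o → outcome (leftmost L (e ∷ R)) ≡ just o
leftmost-here L e R h with safeStepAt L e R
... | just _ = h

leftmost-skip : ∀ L e R → outcome (safeStepAt L e R) ≡ nothing →
                outcome (leftmost L (e ∷ R)) ≡ outcome (leftmost (L ++ [ e ]) R)
leftmost-skip L e R h with safeStepAt L e R
... | nothing = outcome-subst (++-assoc L [ e ] R) (leftmost (L ++ [ e ]) R)

σ-follows-leftmost : ∀ E ap {o} → outcome (leftmost [] E) ≡ just o → proj₁ (proj₂ (σ E ap)) ≡ o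
σ-follows-leftmost E ap h with leftmost [] E
... | just _ = just-injective h

σ-found-avoids-act6 : ∀ E ap {o} → outcome (leftmost [] E) ≡ just o → proj₁ (σ E ap) ≢ act6
σ-found-avoids-act6 E ap h with leftmost [] E
... | just (_ , _ , _ , a≢act6) = a≢act6

data Resolves (P : EqSet → Set) (L M : EqSet) : Set where
  stuck : outcome (leftmost L M) ≡ nothing → ¬ Applicable (L ++ M) → Resolves P L M
  fails : outcome (leftmost L M) ≡ just halt → Resolves P L M
  moves : ∀ {E'} → outcome (leftmost L M) ≡ just (next E') → P E' → Resolves P L M

resolves-transfer : ∀ {P L M L' M'} → outcome (leftmost L M) ≡ outcome (leftmost L' M') →
                    L ++ M ≡ L' ++ M' → Resolves P L' M' → Resolves P L M
resolves-transfer eq eqE (stuck h ¬ap)  = stuck (trans eq h) (¬ap ∘ subst Applicable eqE)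
resolves-transfer eq eqE (fails h)      = fails (trans eq h)
resolves-transfer eq eqE (moves h p)    = moves (trans eq h) p

next-injective : ∀ {E F} → next E ≡ next F → E ≡ F
next-injective refl = refl

data Leads (P : EqSet → Set) (E : EqSet) : Set where
  now   : P E → Leads P E
  after : ∀ {E'} → outcome (leftmost [] E) ≡ just (next E') → Leads P E' → Leads P E

module _ {P : EqSet → Set} (resolves : ∀ {E} → P E → Resolves P [] E) where

  σ-step : ∀ {E} → Leads P E → (ap : Applicable E) →
           proj₁ (σ E ap) ≢ act6 × (∀ {E'} → proj₁ (proj₂ (σ E ap)) ≡ next E' → Leads P E')
  σ-step {E} (now p) ap with resolves p
  ... | stuck _ ¬ap = ⊥-elim (¬ap ap)
  ... | fails h     = σ-found-avoids-act6 E ap h ,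
                      λ e → ⊥-elim (halt≢next (trans (sym (σ-follows-leftmost E ap h)) e))
    where
    halt≢next : ∀ {E'} → halt ≢ next E'
    halt≢next ()
  ... | moves h p'  = σ-found-avoids-act6 E ap h ,
                      λ e → subst (Leads P) (next-injective (trans (sym (σ-follows-leftmost E ap h)) e))
                                  (now p')
  σ-step {E} (after h l) ap =
    σ-found-avoids-act6 E ap h ,
    λ e → subst (Leads P) (next-injective (trans (sym (σ-follows-leftmost E ap h)) e)) l

  leads-reaches : ∀ {E₀ E} → Leads P E₀ → Reaches σ E₀ E → Leads P E
  leads-reaches l start         = l
  leads-reaches l (cont r ap e) = proj₂ (σ-step (leads-reaches l r) ap) e

  leads⇒noOccurCheckHalt : ∀ {E₀} → Leads P E₀ → NoOccurCheckHalt σ E₀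
  leads⇒noOccurCheckHalt l E r ap = proj₁ (σ-step (leads-reaches l r) ap)

leftmost-skips-solved : ∀ L θ M → Solved θ → Disjoint (dom θ) (varsE L) → Disjoint (dom θ) (varsE M) →
  outcome (leftmost L (toEqs θ ++ M)) ≡ outcome (leftmost (L ++ toEqs θ) M)
leftmost-skips-solved L [] M _ _ _ = cong (λ L' → outcome (leftmost L' M)) (sym (++-identityʳ L))
leftmost-skips-solved L ((x , u) ∷ θ) M solved dom#L dom#M = begin
  outcome (leftmost L ((var x , u) ∷ toEqs θ ++ M))
    ≡⟨ leftmost-skip L (var x , u) (toEqs θ ++ M) (varStep-inert L x u (toEqs θ ++ M) x∉u x∉rest) ⟩
  outcome (leftmost (L ++ [ (var x , u) ]) (toEqs θ ++ M))
    ≡⟨ leftmost-skips-solved (L ++ [ (var x , u) ]) θ M (solved-∷⁻ solved) dom#L'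
                             (λ (p , q) → dom#M (there p , q)) ⟩
  outcome (leftmost ((L ++ [ (var x , u) ]) ++ toEqs θ) M)
    ≡⟨ cong (λ L' → outcome (leftmost L' M)) (++-assoc L _ (toEqs θ)) ⟩
  outcome (leftmost (L ++ toEqs ((x , u) ∷ θ)) M) ∎
  where
  open ≡-Reasoning
  open Solved solved
  x∉u = proj₁ (solved-head-fresh solved)
  x∉rest : x ∉ varsE (L ++ toEqs θ ++ M)
  x∉rest p with ∈-varsE-++⁻ L _ p
  ... | inj₁ q = dom#L (here refl , q)
  ... | inj₂ q with ∈-varsE-++⁻ (toEqs θ) M q
  ...   | inj₁ r = proj₂ (solved-head-fresh solved) r
  ...   | inj₂ r = dom#M (here refl , r)
  dom#L' : Disjoint (dom θ) (varsE (L ++ [ (var x , u) ]))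
  dom#L' (p , q) with ∈-varsE-++⁻ L _ q
  ... | inj₁ r                   = dom#L (there p , r)
  ... | inj₂ (here refl)         = Unique[x∷xs]⇒x∉xs dom-unique p
  ... | inj₂ (there r) = dom#ran (there p , ∈-++⁺ˡ (subst (_ ∈_) (++-identityʳ (vars u)) r))

solved-selected : ∀ θ L e R → Solved θ → toEqs θ ≡ L ++ e ∷ R →
  ∃ λ y → ∃ λ u → e ≡ (var y , u) × y ∈ dom θ × y ∉ vars u × y ∉ varsE (L ++ R)
solved-selected ((y , u) ∷ θ) [] _ _ solved refl = y , u , refl , here refl , solved-head-fresh solved
solved-selected ((z , w) ∷ θ) (l ∷ L) e R solved eq with ∷-injective eq
... | refl , eq' with solved-selected θ L e R (solved-∷⁻ solved) eq'
...   | y , u , refl , y∈dom , y∉u , y∉LR = y , u , refl , there y∈dom , y∉u , y∉lLR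
  where
  open Solved solved
  y∉lLR : y ∉ varsE ((var z , w) ∷ L ++ R)
  y∉lLR (here refl) = Unique[x∷xs]⇒x∉xs dom-unique y∈dom
  y∉lLR (there p) with ∈-++⁻ (vars w) p
  ... | inj₁ q = dom#ran (there y∈dom , ∈-++⁺ˡ q)
  ... | inj₂ q = y∉LR q

solved-irreducible : ∀ θ → Solved θ → ¬ Applicable (toEqs θ)
solved-irreducible θ solved (_ , _ , st) = irreducible st refl
  where
  selected = solved-selected θ
  irreducible : ∀ {E a o} → Step E a o → E ≡ toEqs θ → ⊥
  irreducible (step1 L R f ss ts _) eq with selected L _ R solved (sym eq)
  ... | _ , _ , () , _
  irreducible (step2 L R f g ss ts _) eq with selected L _ R solved (sym eq)
  ... | _ , _ , () , _
  irreducible (step3 L R x) eq with selected L _ R solved (sym eq)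
  ... | _ , _ , refl , _ , x∉x , _ = x∉x (here refl)
  irreducible (step4 L R t x t-nonvar) eq with selected L _ R solved (sym eq)
  ... | y , _ , refl , _ = t-nonvar (y , refl)
  irreducible (step5 L R x t _ x∈LR) eq with selected L _ R solved (sym eq)
  ... | _ , _ , refl , _ , _ , x∉LR = x∉LR x∈LR
  irreducible (step6 L R x t x∈t _) eq with selected L _ R solved (sym eq)
  ... | _ , _ , refl , _ , x∉t , _ = x∉t x∈t

record Staged (θ : Subst) (U : EqSet) : Set where
  field
    solved     : Solved θ
    dom#U      : Disjoint (dom θ) (varsE U)
    rhs-linear : Unique (rhsVars U)
    lhs#rhs    : Disjoint (lhsVars U) (rhsVars U)
    ran#rhs    : Disjoint (ranVars θ) (rhsVars U)

-- Y = r is the next equation to be eliminated; r need not be linear, as action (4) may have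
-- brought a left-hand side to the right.
record Pivot (θ : Subst) (Y : ℕ) (r : Term) (U : EqSet) : Set where
  field
    rest  : Staged θ U
    Y∉dom : Y ∉ dom θ
    dom#r : Disjoint (dom θ) (vars r)
    Y∉r   : Y ∉ vars r
    Y∉rhs : Y ∉ rhsVars U
    r#rhs : Disjoint (vars r) (rhsVars U)
  open Staged rest public

data Stage : EqSet → Set where
  staged : ∀ {θ U} → Staged θ U → Stage (toEqs θ ++ U)
  pivot  : ∀ {θ Y r U} → Pivot θ Y r U → Stage (toEqs θ ++ (var Y , r) ∷ U)

staged-∷⁻ : ∀ {θ a b U} → Staged θ ((a , b) ∷ U) → Staged θ U
staged-∷⁻ {a = a} {b} s = record
  { solved     = solved
  ; dom#U      = λ (p , q) → dom#U (p , ∈-++⁺ʳ (vars a) (∈-++⁺ʳ (vars b) q))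
  ; rhs-linear = unique-++⁻ʳ (vars b) rhs-linear
  ; lhs#rhs    = λ (p , q) → lhs#rhs (∈-++⁺ʳ (vars a) p , ∈-++⁺ʳ (vars b) q)
  ; ran#rhs    = λ (p , q) → ran#rhs (p , ∈-++⁺ʳ (vars b) q) }
  where open Staged s

staged-respects : ∀ {θ U V} → lhsVars U ≡ lhsVars V → rhsVars U ≡ rhsVars V → Staged θ U → Staged θ V
staged-respects {θ} {U} {V} lhsEq rhsEq s = record
  { solved     = solved
  ; dom#U      = λ (p , q) → dom#U (p , fromV (∈-varsE⁻ V q))
  ; rhs-linear = subst Unique rhsEq rhs-linear
  ; lhs#rhs    = λ (p , q) → lhs#rhs (subst (_ ∈_) (sym lhsEq) p , subst (_ ∈_) (sym rhsEq) q)
  ; ran#rhs    = λ (p , q) → ran#rhs (p , subst (_ ∈_) (sym rhsEq) q) }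
  where
  open Staged s
  fromV : ∀ {x} → x ∈ lhsVars V ⊎ x ∈ rhsVars V → x ∈ varsE U
  fromV (inj₁ p) = ∈-varsE⁺ˡ U (subst (_ ∈_) (sym lhsEq) p)
  fromV (inj₂ q) = ∈-varsE⁺ʳ U (subst (_ ∈_) (sym rhsEq) q)

staged-decompose : ∀ {θ f ss ts U} → length ss ≡ length ts →
                   Staged θ ((fn f ss , fn f ts) ∷ U) → Staged θ (zip ss ts ++ U)
staged-decompose {ss = ss} {ts} {U} len =
  staged-respects (sym (lhsVars-zip-++ ss ts U len)) (sym (rhsVars-zip-++ ss ts U len))

staged-pivot : ∀ {θ Y t U} → Staged θ ((var Y , t) ∷ U) → Pivot θ Y t U
staged-pivot {t = t} s = record
  { rest  = staged-∷⁻ s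
  ; Y∉dom = λ p → dom#U (p , here refl)
  ; dom#r = λ (p , q) → dom#U (p , there (∈-++⁺ˡ q))
  ; Y∉r   = λ q → lhs#rhs (here refl , ∈-++⁺ˡ q)
  ; Y∉rhs = λ q → lhs#rhs (here refl , ∈-++⁺ʳ (vars t) q)
  ; r#rhs = unique-++⇒disjoint (vars t) rhs-linear }
  where open Staged s

staged-swap : ∀ {θ f ss X U} → Staged θ ((fn f ss , var X) ∷ U) → Pivot θ X (fn f ss) U
staged-swap {ss = ss} s = record
  { rest  = staged-∷⁻ s
  ; Y∉dom = λ p → dom#U (p , ∈-++⁺ʳ (varsL ss) (here refl))
  ; dom#r = λ (p , q) → dom#U (p , ∈-++⁺ˡ q)
  ; Y∉r   = λ q → lhs#rhs (∈-++⁺ˡ q , here refl)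
  ; Y∉rhs = Unique[x∷xs]⇒x∉xs rhs-linear
  ; r#rhs = λ (p , q) → lhs#rhs (∈-++⁺ˡ p , there q) }
  where open Staged s

pivot-eliminate : ∀ {θ Y r U} → Pivot θ Y r U → Staged (extend Y r θ) (substE Y r U)
pivot-eliminate {θ} {Y} {r} {U} pv = record
  { solved     = solved-extend solved Y∉dom dom#r Y∉r
  ; dom#U      = λ (p , q) → extend-disjoint dom#U dom#r Y∉r
                               (∈-dom-extend⁻ {Y} {r} {θ} p) (∈-varsE-substE⁻ Y r U q)
  ; rhs-linear = subst Unique (sym rhsEq) rhs-linear
  ; lhs#rhs    = λ (p , q) → lhs#rhs' (∈-lhsVars-substE⁻ Y r U p) (subst (_ ∈_) rhsEq q)
  ; ran#rhs    = λ (p , q) → ran#rhs' (∈-ranVars-extend⁻ {Y} {r} {θ} p) (subst (_ ∈_) rhsEq q) }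
  where
  open Pivot pv
  rhsEq : rhsVars (substE Y r U) ≡ rhsVars U
  rhsEq = rhsVars-substE-fresh Y r U Y∉rhs
  lhs#rhs' : ∀ {x} → (x ∈ lhsVars U × x ≢ Y) ⊎ x ∈ vars r → x ∉ rhsVars U
  lhs#rhs' (inj₁ (p , _)) q = lhs#rhs (p , q)
  lhs#rhs' (inj₂ p)       q = r#rhs (p , q)
  ran#rhs' : ∀ {x} → (x ∈ ranVars θ × x ≢ Y) ⊎ x ∈ vars r → x ∉ rhsVars U
  ran#rhs' (inj₁ (p , _)) q = ran#rhs (p , q)
  ran#rhs' (inj₂ p)       q = r#rhs (p , q)

pivot-inert : ∀ {θ Y r U} → Pivot θ Y r U → Y ∉ varsE (toEqs θ ++ U) → Staged (θ ++ [ (Y , r) ]) U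
pivot-inert {θ} {Y} {r} {U} pv Y∉ = subst₂ Staged
  (cong (_++ [ (Y , r) ]) (substS-fresh Y r θ (Y∉ ∘ ∈-varsE-++⁺ˡ (toEqs θ) U ∘ ∈-varsE-toEqs⁺ θ)))
  (substE-fresh Y r U (Y∉ ∘ ∈-varsE-++⁺ʳ (toEqs θ) U))
  (pivot-eliminate pv)

mutual
  resolve-staged : ∀ θ U → Staged θ U → Resolves Stage (toEqs θ) U
  resolve-staged θ [] s =
    stuck refl (solved-irreducible θ (Staged.solved s) ∘ subst Applicable (++-identityʳ (toEqs θ)))
  resolve-staged θ ((var Y , t) ∷ U) s = resolve-pivot θ Y t U (staged-pivot s)
  resolve-staged θ ((fn f ss , var X) ∷ U) s = moves refl (pivot (staged-swap s))
  resolve-staged θ ((fn f ss , fn g ts) ∷ U) s with (f ≟Sym g) ×-dec (length ss ≟ length ts)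
  ... | yes same@(refl , len) =
    moves (leftmost-here (toEqs θ) (fn f ss , fn f ts) U (safeStepAt-decomposes (toEqs θ) f g ss ts U same))
          (staged (staged-decompose len s))
  ... | no clash =
    fails (leftmost-here (toEqs θ) (fn f ss , fn g ts) U (safeStepAt-clashes (toEqs θ) f g ss ts U clash))

  resolve-pivot : ∀ θ Y r U → Pivot θ Y r U → Resolves Stage (toEqs θ) ((var Y , r) ∷ U)
  resolve-pivot θ Y r U pv with Y ∈? varsE (toEqs θ ++ U)
  ... | yes Y∈ =
    moves (leftmost-here (toEqs θ) (var Y , r) U (varStep-eliminates (toEqs θ) Y r U Y∉r Y∈))
          (subst Stage (sym (toEqs-extend θ Y r U Y∉dom)) (staged (pivot-eliminate pv)))
    where open Pivot pv
  ... | no Y∉ = resolves-transfer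
    (trans (leftmost-skip (toEqs θ) (var Y , r) U (varStep-inert (toEqs θ) Y r U Y∉r Y∉))
           (cong (λ L → outcome (leftmost L U)) (toEqs-∷ʳ θ Y r)))
    (trans (sym (++-assoc (toEqs θ) _ U)) (cong (_++ U) (toEqs-∷ʳ θ Y r)))
    (resolve-staged (θ ++ [ (Y , r) ]) U (pivot-inert pv Y∉))
    where open Pivot pv

resolve : ∀ {E} → Stage E → Resolves Stage [] E
resolve (staged {θ} {U} s) =
  resolves-transfer (leftmost-skips-solved [] θ U solved (λ ()) dom#U) refl (resolve-staged θ U s)
  where open Staged s
resolve (pivot {θ} {Y} {r} {U} pv) =
  resolves-transfer (leftmost-skips-solved [] θ _ solved (λ ()) dom#YrU) refl (resolve-pivot θ Y r U pv)
  where
  open Pivot pv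
  dom#YrU : Disjoint (dom θ) (varsE ((var Y , r) ∷ U))
  dom#YrU (p , here refl) = Y∉dom p
  dom#YrU (p , there q) with ∈-++⁻ (vars r) q
  ... | inj₁ q' = dom#r (p , q')
  ... | inj₂ q' = dom#U (p , q')

mutual
  applyS-ground : ∀ θ t → Ground t → applyS θ t ≡ t
  applyS-ground θ (fn f ts) gr = cong (fn f) (applySL-ground θ ts gr)

  applySL-ground : ∀ θ ts → varsL ts ≡ [] → applySL θ ts ≡ ts
  applySL-ground θ []       _  = refl
  applySL-ground θ (t ∷ ts) gr = cong₂ _∷_ (applyS-ground θ t (++-conicalˡ (vars t) (varsL ts) gr))
                                           (applySL-ground θ ts (++-conicalʳ (vars t) (varsL ts) gr))

lookupS-vars⁻ : ∀ θ x {y} → y ∈ vars (lookupS θ x) → y ≡ x ⊎ y ∈ ranVars θ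
lookupS-vars⁻ []            x (here eq) = inj₁ eq
lookupS-vars⁻ ((z , t) ∷ θ) x p with z ≟ x
... | yes _ = inj₂ (∈-++⁺ˡ p)
... | no _  = Sum.map₂ (∈-++⁺ʳ (vars t)) (lookupS-vars⁻ θ x p)

mutual
  applyS-vars⁻ : ∀ θ t {y} → y ∈ vars (applyS θ t) → y ∈ vars t ⊎ y ∈ ranVars θ
  applyS-vars⁻ θ (var x)   p = Sum.map₁ (λ { refl → here refl }) (lookupS-vars⁻ θ x p)
  applyS-vars⁻ θ (fn f ts) p = applySL-vars⁻ θ ts p

  applySL-vars⁻ : ∀ θ ts {y} → y ∈ varsL (applySL θ ts) → y ∈ varsL ts ⊎ y ∈ ranVars θ
  applySL-vars⁻ θ (t ∷ ts) p with ∈-++⁻ (vars (applyS θ t)) p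
  ... | inj₁ q = Sum.map₁ ∈-++⁺ˡ (applyS-vars⁻ θ t q)
  ... | inj₂ q = Sum.map₁ (∈-++⁺ʳ (vars t)) (applySL-vars⁻ θ ts q)

first-args-equal : ∀ {f g t u ts us} → fn f (t ∷ ts) ≡ fn g (u ∷ us) → t ≡ u
first-args-equal refl = refl

ground-unified : ∀ θ t u → applyS θ t ≡ applyS θ u → Ground t → Ground (applyS θ u)
ground-unified θ t u eq gr = subst Ground (trans (sym (applyS-ground θ t gr)) eq) gr

ground-s⁻ : ∀ t → Ground (s t) → Ground t
ground-s⁻ t gr = trans (sym (++-identityʳ (vars t))) gr

-- The first argument of pqs and pq is the input position.
data WellModed : Term → Set where
  pqs-wm : ∀ g a b c → Ground g → WellModed (pqs g a b c)
  pq-wm  : ∀ g a b c → Ground g → WellModed (pq g a b c)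

wellModed-applyS : ∀ θ {A} → WellModed A → WellModed (applyS θ A)
wellModed-applyS θ (pqs-wm g _ _ _ gr) = pqs-wm _ _ _ _ (subst Ground (sym (applyS-ground θ g gr)) gr)
wellModed-applyS θ (pq-wm  g _ _ _ gr) = pq-wm  _ _ _ _ (subst Ground (sym (applyS-ground θ g gr)) gr)

body-wellModed : ∀ {c A θ ρ} → c ∈ NQUEENS → WellModed A → Unifier θ A (head (renameC ρ c)) →
                 All (WellModed ∘ applyS θ) (body (renameC ρ c))
body-wellModed {θ = θ} {ρ} (there (here refl)) (pqs-wm g _ _ _ gr) un =
  pqs-wm _ _ _ _ (ground-s⁻ (lookupS θ (ρ 0)) sI-ground) ∷ pq-wm _ _ _ _ sI-ground ∷ []
  where sI-ground = ground-unified θ g (s (var (ρ 0))) (first-args-equal un) gr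
body-wellModed {θ = θ} {ρ} (there (there (there (here refl)))) (pq-wm g _ _ _ gr) un =
  pq-wm _ _ _ _ (ground-unified θ g (var (ρ 0)) (first-args-equal un) gr) ∷ []
body-wellModed (here refl)                         _ _ = []
body-wellModed (there (there (here refl)))         _ _ = []
body-wellModed (there (here refl))                 (pq-wm _ _ _ _ _)  ()
body-wellModed (there (there (there (here refl)))) (pqs-wm _ _ _ _ _) ()

all-applySL : ∀ θ {P : Term → Set} Q → All (P ∘ applyS θ) Q → All P (applySL θ Q)
all-applySL θ []      []       = []
all-applySL θ (A ∷ Q) (p ∷ ps) = p ∷ all-applySL θ Q ps

∈-varsL-++⁻ : ∀ ts us {x} → x ∈ varsL (ts ++ us) → x ∈ varsL ts ⊎ x ∈ varsL us
∈-varsL-++⁻ ts us {x} p = ∈-++⁻ (varsL ts) (subst (x ∈_) (varsL-++ ts us) p)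

∈-varsL-++⁺ʳ : ∀ ts us {x} → x ∈ varsL us → x ∈ varsL (ts ++ us)
∈-varsL-++⁺ʳ ts us {x} p = subst (x ∈_) (sym (varsL-++ ts us)) (∈-++⁺ʳ (varsL ts) p)

∈-varsL-++⁺ˡ : ∀ ts us {x} → x ∈ varsL ts → x ∈ varsL (ts ++ us)
∈-varsL-++⁺ˡ ts us {x} p = subst (x ∈_) (sym (varsL-++ ts us)) (∈-++⁺ˡ p)

sld-invariant : ∀ {n t₁ t₂ t₃ Q U} → Ground n → SLDReach NQUEENS (pqs n t₁ t₂ t₃ ∷ []) Q U →
                All WellModed Q × varsL Q ⊆ U
sld-invariant gr start = pqs-wm _ _ _ _ gr ∷ [] , λ p → p
sld-invariant gr (step {U} L A R c' θ reach (c , c∈ , ρ , _ , refl , _) _ (_ , un , _)) =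
  all-applySL θ (L ++ body c' ++ R)
    (AllP.++⁺ (All.map (wellModed-applyS θ) wmL)
              (AllP.++⁺ (body-wellModed c∈ wmA un) (All.map (wellModed-applyS θ) wmR))) ,
  vars⊆
  where
  ih = sld-invariant gr reach
  wmL = AllP.++⁻ˡ L (proj₁ ih)
  wmA∷R = AllP.++⁻ʳ L (proj₁ ih)
  wmA = All.head wmA∷R
  wmR = All.tail wmA∷R
  vars⊆ : varsL (applySL θ (L ++ body c' ++ R)) ⊆ U ++ varsC c' ++ varsS θ
  vars⊆ p with applySL-vars⁻ θ (L ++ body c' ++ R) p
  ... | inj₂ q = ∈-++⁺ʳ U (∈-++⁺ʳ (varsC c') (∈-++⁺ʳ (map proj₁ θ) q))
  ... | inj₁ q with ∈-varsL-++⁻ L (body c' ++ R) q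
  ...   | inj₁ q' = ∈-++⁺ˡ (proj₂ ih (∈-varsL-++⁺ˡ L (A ∷ R) q'))
  ...   | inj₂ q' with ∈-varsL-++⁻ (body c') R q'
  ...     | inj₁ q'' = ∈-++⁺ʳ U (∈-++⁺ˡ (∈-++⁺ʳ (vars (head c')) q''))
  ...     | inj₂ q'' = ∈-++⁺ˡ (proj₂ ih (∈-varsL-++⁺ʳ L (A ∷ R) (∈-++⁺ʳ (vars A) q'')))

linear-head-stage : ∀ A H → Unique (vars H) → Disjoint (vars A) (vars H) → Stage ((A , H) ∷ [])
linear-head-stage A H H-linear A#H = staged {θ = []} record
  { solved     = record { dom-unique = [] ; dom#ran = λ { (() , _) } }
  ; dom#U      = λ { (() , _) }
  ; rhs-linear = subst Unique (sym (++-identityʳ (vars H))) H-linear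
  ; lhs#rhs    = λ (p , q) → A#H (subst (_ ∈_) (++-identityʳ (vars A)) p ,
                                  subst (_ ∈_) (++-identityʳ (vars H)) q)
  ; ran#rhs    = λ { (() , _) } }

ground-∉ : ∀ {t x} → Ground t → x ∉ vars t
ground-∉ gr p = ¬Any[] (subst (_ ∈_) gr p)

head₃ : (ℕ → ℕ) → Term
head₃ ρ = pq (var (ρ 0)) [ var (ρ 0) ∣ var (ρ 1) ] [ var (ρ 0) ∣ var (ρ 2) ] [ var (ρ 0) ∣ var (ρ 3) ]

ground-input-leads : ∀ {ρ} → Injective _≡_ _≡_ ρ → ∀ g a b c → Ground g →
  Disjoint (vars (pq g a b c)) (vars (head₃ ρ)) → Leads Stage ((pq g a b c , head₃ ρ) ∷ [])
ground-input-leads {ρ} inj g@(fn f gs) a b c gr A#H =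
  -- actions (1), (4) and (5): decompose, orient g = I, eliminate I
  after refl (after refl (after (leftmost-here [] (var I , g) rest (varStep-eliminates [] I g rest I∉g I∈rest))
    (now (subst Stage (cong ((var I , g) ∷_) (sym rest≡U)) (staged staged-U)))))
  where
  I = ρ 0
  rest U : EqSet
  rest = (a , [ var I ∣ var (ρ 1) ]) ∷ (b , [ var I ∣ var (ρ 2) ]) ∷ (c , [ var I ∣ var (ρ 3) ]) ∷ []
  U    = (a , [ g ∣ var (ρ 1) ]) ∷ (b , [ g ∣ var (ρ 2) ]) ∷ (c , [ g ∣ var (ρ 3) ]) ∷ []
  I∉g : I ∉ vars g
  I∉g = ground-∉ {g} gr
  I∈rest : I ∈ varsE rest
  I∈rest = ∈-++⁺ʳ (vars a) (here refl)
  I∉lhs : I ∉ lhsVars U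
  I∉lhs p = A#H (∈-++⁺ʳ (vars g) p , here refl)
  I≢ : ∀ {k} → k ≢ 0 → ρ k ≢ I
  I≢ k≢0 = k≢0 ∘ inj
  rest≡U : substE I g rest ≡ U
  rest≡U rewrite subst1-fresh I g a (I∉lhs ∘ ∈-++⁺ˡ)
               | subst1-fresh I g b (I∉lhs ∘ ∈-++⁺ʳ (vars a) ∘ ∈-++⁺ˡ)
               | subst1-fresh I g c (I∉lhs ∘ ∈-++⁺ʳ (vars a) ∘ ∈-++⁺ʳ (vars b) ∘ ∈-++⁺ˡ)
               | subst1-var-self I g
               | subst1-fresh I g (var (ρ 1)) (λ { (here e) → I≢ (λ ()) (sym e) })
               | subst1-fresh I g (var (ρ 2)) (λ { (here e) → I≢ (λ ()) (sym e) })
               | subst1-fresh I g (var (ρ 3)) (λ { (here e) → I≢ (λ ()) (sym e) }) = refl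
  rhsVars-U : rhsVars U ≡ map (ρ ∘ suc) (upTo 3)
  rhsVars-U rewrite gr = refl
  rhs⊆H : ∀ {x} → x ∈ map (ρ ∘ suc) (upTo 3) → x ∈ vars (head₃ ρ)
  rhs⊆H (here refl)                 = there (there (here refl))
  rhs⊆H (there (here refl))         = there (there (there (there (here refl))))
  rhs⊆H (there (there (here refl))) = there (there (there (there (there (there (here refl))))))
  rhs≢I : ∀ {x} → x ∈ map (ρ ∘ suc) (upTo 3) → x ≢ I
  rhs≢I (here refl)                 = I≢ λ ()
  rhs≢I (there (here refl))         = I≢ λ ()
  rhs≢I (there (there (here refl))) = I≢ λ ()
  ran∌ : ∀ {x} → x ∉ ranVars ((I , g) ∷ [])
  ran∌ p = ground-∉ {g} gr (subst (_ ∈_) (++-identityʳ (vars g)) p)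
  staged-U : Staged ((I , g) ∷ []) U
  staged-U = record
    { solved     = record { dom-unique = [] ∷ [] ; dom#ran = ran∌ ∘ proj₂ }
    ; dom#U      = λ { (here refl , q) → dom#U (∈-varsE⁻ U q) }
    ; rhs-linear = subst Unique (sym rhsVars-U) (map⁺ (suc-injective ∘ inj) (upTo⁺ 3))
    ; lhs#rhs    = λ (p , q) → A#H (∈-++⁺ʳ (vars g) p , rhs⊆H (subst (_ ∈_) rhsVars-U q))
    ; ran#rhs    = ran∌ ∘ proj₁ }
    where
    dom#U : I ∈ lhsVars U ⊎ I ∈ rhsVars U → ⊥
    dom#U (inj₁ p) = I∉lhs p
    dom#U (inj₂ q) = rhs≢I (subst (_ ∈_) rhsVars-U q) refl

available-leads : ∀ {n t₁ t₂ t₃ A H} → Ground n → Available NQUEENS (pqs n t₁ t₂ t₃ ∷ []) A H →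
                  Leads Stage ((A , H) ∷ [])
available-leads {A = A} gr (L , R , U , reach , _ , (c , c∈ , ρ , inj , refl , apart) , refl , same) =
  from-clause c∈ (All.head (AllP.++⁻ʳ L wellModed)) same
  where
  wellModed = proj₁ (sld-invariant gr reach)
  vars⊆U    = proj₂ (sld-invariant gr reach)
  A#H : Disjoint (vars A) (vars (head (renameC ρ c)))
  A#H (p , q) = apart _ (∈-++⁺ˡ q) (vars⊆U (∈-varsL-++⁺ʳ L (A ∷ R) (∈-++⁺ˡ p)))
  from-clause : c ∈ NQUEENS → WellModed A → SameSymbol A (head (renameC ρ c)) →
                Leads Stage ((A , head (renameC ρ c)) ∷ [])
  from-clause (here refl)                         _ _ = now (linear-head-stage _ _ (map⁺ inj (upTo⁺ 3)) A#H)
  from-clause (there (here refl))                 _ _ = now (linear-head-stage _ _ (map⁺ inj (upTo⁺ 5)) A#H)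
  from-clause (there (there (there (here refl)))) _ _ = now (linear-head-stage _ _ (map⁺ inj (upTo⁺ 7)) A#H)
  from-clause (there (there (here refl))) (pq-wm g a b d gr) _ = ground-input-leads inj g a b d gr A#H
  from-clause (there (there (here refl))) (pqs-wm _ _ _ _ _) (() , _)

proposition5 : Σ Strategy (λ σ → ∀ n t₁ t₂ t₃ → Ground n →
                 ∀ A H → Available NQUEENS (pqs n t₁ t₂ t₃ ∷ []) A H →
                 NoOccurCheckHalt σ ((A , H) ∷ []))
proposition5 = σ , λ n t₁ t₂ t₃ gr A H available →
  leads⇒noOccurCheckHalt resolve (available-leads gr available)
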